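{- Let $G$ be a connected graph on $n$ vertices that contains a pendant triangle. Then $F(G)\geq n-2$.
   Context: All graphs are finite and simple. A vertex $v$ is a cut-vertex of $G$ if $G-v$ has more components than $G$. A pendant triangle (pendant $K_3$) in $G$ consists of a cut-vertex $v$ of degree $3$ adjacent to two vertices $u$ and $w$ which are adjacent to each other and both have degree $2$. Given a graph $G$ and a set $S\subseteq V(G)$, the forcing rule is: if a vertex $v\in S$ has exactly one neighbor $u$ not in $S$, then $u$ is added to $S$. A set $S$ is a failed zero-forcing set of $G$ if repeated application of the forcing rule starting from $S$ does not result in all vertices of $G$ being in $S$. The failed zero-forcing number $F(G)$ is the maximum cardinality of a failed zero-forcing set of $G$. -}

module Defs where

open import Data.Nat using (ℕ; _≥_; _∸_)
open import Data.Fin using (Fin)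
open import Data.Fin.Subset using (Subset; _∈_; _∉_; ∣_∣)
open import Data.Bool using (Bool; true; false; T)
open import Data.Vec using (tabulate)
open import Data.Product using (Σ; ∃; ∃-syntax; _×_; _,_)
open import Relation.Binary.PropositionalEquality using (_≡_; _≢_)
open import Relation.Nullary using (¬_)
open import Data.Empty using (⊥)

record Graph (n : ℕ) : Set where
  field
    adj   : Fin n → Fin n → Bool
    sym   : ∀ x y → adj x y ≡ adj y x
    irrefl : ∀ x → adj x x ≡ false

open Graph public

module _ {n : ℕ} (G : Graph n) where

  Adj : Fin n → Fin n → Set
  Adj x y = T (adj G x y)

  N : Fin n → Subset n
  N v = tabulate (adj G v)

  deg : Fin n → ℕ
  deg v = ∣ N v ∣

  -- walks in G all of whose vertices lie outside the set X
  -- (X = ∅ gives ordinary reachability; X = {v} gives reachability in G - v)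
  data ReachAvoid (X : Fin n → Set) : Fin n → Fin n → Set where
    here  : ∀ {x} → ¬ X x → ReachAvoid X x x
    step  : ∀ {x y z} → ¬ X x → Adj x y → ReachAvoid X y z → ReachAvoid X x z

  Reachable : Fin n → Fin n → Set
  Reachable = ReachAvoid (λ _ → ⊥)

  Connected : Set
  Connected = ∀ x y → Reachable x y

  -- v is a cut-vertex: G - v has more components than G, i.e. there are
  -- two vertices other than v lying in the same component of G that lie
  -- in different components of G - v.
  IsCutVertex : Fin n → Set
  IsCutVertex v = ∃[ x ] ∃[ y ] (x ≢ v × y ≢ v × Reachable x y
                                 × ¬ ReachAvoid (λ z → z ≡ v) x y)

  HasPendantTriangle : Set
  HasPendantTriangle =
    ∃[ v ] ∃[ u ] ∃[ w ] (IsCutVertex v × deg v ≡ 3 × Adj v u × Adj v w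
                          × Adj u w × deg u ≡ 2 × deg w ≡ 2)

  data Closure (S : Subset n) : Fin n → Set where
    base  : ∀ {x} → x ∈ S → Closure S x
    force : ∀ {v u} → Closure S v → Adj v u
          → (∀ w → Adj v w → w ≢ u → Closure S w) → Closure S u

  IsFailedZeroForcingSet : Subset n → Set
  IsFailedZeroForcingSet S = ∃[ x ] ¬ Closure S x

  -- F(G) ≥ k : some failed zero-forcing set has at least k elements
  -- (F(G) is the maximum size of a failed zero-forcing set)
  FailedZFNumber≥ : ℕ → Set
  FailedZFNumber≥ k = ∃[ S ] (IsFailedZeroForcingSet S × ∣ S ∣ ≥ k)

{-# OPTIONS --safe #-}
-- The two degree-2 vertices u, w of a pendant triangle are adjacent twins:
-- a third vertex is adjacent to u iff it is adjacent to w. A vertex other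
-- than u, w that sees one of them therefore sees both and never forces
-- either, so V ∖ {u, w} is a failed zero-forcing set with n − 2 elements.
module Submission where

open import Defs hiding (sym)
open import Data.Nat using (ℕ; _∸_; _+_; _≤_; _<_; _≥_; z≤n; s≤s)
open import Data.Nat.Properties
  using (≤-trans; ≤-reflexive; +-suc; +-monoʳ-≤; ∸-monoʳ-≤; <-irrefl)
open import Data.Fin using (Fin; _≟_)
open import Data.Fin.Subset
  using (Subset; _∈_; _∉_; ∣_∣; inside; outside; ⁅_⁆; _∪_; ∁; _-_)
open import Data.Fin.Subset.Properties
  using (∣p∣≤∣x∷p∣; x∈p⇒∣p-x∣<∣p∣; x∈p∧x≢y⇒x∈p-y; ∣⁅x⁆∣≡1; ∣∁p∣≡n∸∣p∣; x∈⁅x⁆; x∈p∪q⁺; x∈p⇒x∉∁p)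
open import Data.Vec using (_∷_; [])
open import Data.Vec.Properties using (lookup⇒[]=; lookup∘tabulate)
open import Data.Bool using (T)
open import Data.Bool.Properties using (T-≡)
open import Data.Product using (_×_; _,_; proj₁; proj₂)
open import Data.Sum using (_⊎_; inj₁; inj₂)
open import Data.Empty using (⊥-elim)
open import Function.Bundles using (_⇔_; mk⇔; Equivalence)
open import Relation.Nullary using (yes; no)
open import Relation.Binary.PropositionalEquality
  using (_≡_; _≢_; refl; sym; trans; subst; cong₂; ≢-sym)

open Equivalence using (to; from)

∣p∪q∣≤∣p∣+∣q∣ : ∀ {n} (p q : Subset n) → ∣ p ∪ q ∣ ≤ ∣ p ∣ + ∣ q ∣
∣p∪q∣≤∣p∣+∣q∣ []            []            = z≤n
∣p∪q∣≤∣p∣+∣q∣ (inside  ∷ p) (t       ∷ q) =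
  s≤s (≤-trans (∣p∪q∣≤∣p∣+∣q∣ p q) (+-monoʳ-≤ ∣ p ∣ (∣p∣≤∣x∷p∣ t q)))
∣p∪q∣≤∣p∣+∣q∣ (outside ∷ p) (inside  ∷ q) =
  ≤-trans (s≤s (∣p∪q∣≤∣p∣+∣q∣ p q)) (≤-reflexive (sym (+-suc ∣ p ∣ ∣ q ∣)))
∣p∪q∣≤∣p∣+∣q∣ (outside ∷ p) (outside ∷ q) = ∣p∪q∣≤∣p∣+∣q∣ p q

∣∁⁅x,y⁆∣≥n∸2 : ∀ {n} (x y : Fin n) → ∣ ∁ (⁅ x ⁆ ∪ ⁅ y ⁆) ∣ ≥ n ∸ 2
∣∁⁅x,y⁆∣≥n∸2 {n} x y = subst (n ∸ 2 ≤_) (sym (∣∁p∣≡n∸∣p∣ (⁅ x ⁆ ∪ ⁅ y ⁆))) (∸-monoʳ-≤ n ∣⁅x,y⁆∣≤2)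
  where
  ∣⁅x,y⁆∣≤2 : ∣ ⁅ x ⁆ ∪ ⁅ y ⁆ ∣ ≤ 2
  ∣⁅x,y⁆∣≤2 = subst (∣ ⁅ x ⁆ ∪ ⁅ y ⁆ ∣ ≤_) (cong₂ _+_ (∣⁅x⁆∣≡1 x) (∣⁅x⁆∣≡1 y))
                    (∣p∪q∣≤∣p∣+∣q∣ ⁅ x ⁆ ⁅ y ⁆)

three-distinct⇒2<∣p∣ : ∀ {n} {p : Subset n} {a b c : Fin n} → a ∈ p → b ∈ p → c ∈ p
                     → a ≢ b → a ≢ c → b ≢ c → 2 < ∣ p ∣
three-distinct⇒2<∣p∣ {p = p} {a} {b} {c} a∈p b∈p c∈p a≢b a≢c b≢c =
  ≤-trans (s≤s 2≤∣p-a∣) (x∈p⇒∣p-x∣<∣p∣ a∈p)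
  where
  b∈p-a : b ∈ p - a
  b∈p-a = x∈p∧x≢y⇒x∈p-y b∈p (≢-sym a≢b)
  c∈p-a-b : c ∈ p - a - b
  c∈p-a-b = x∈p∧x≢y⇒x∈p-y (x∈p∧x≢y⇒x∈p-y c∈p (≢-sym a≢c)) (≢-sym b≢c)
  1≤∣p-a-b∣ : 1 ≤ ∣ p - a - b ∣
  1≤∣p-a-b∣ = ≤-trans (s≤s z≤n) (x∈p⇒∣p-x∣<∣p∣ c∈p-a-b)
  2≤∣p-a∣ : 2 ≤ ∣ p - a ∣
  2≤∣p-a∣ = ≤-trans (s≤s 1≤∣p-a-b∣) (x∈p⇒∣p-x∣<∣p∣ b∈p-a)

∣p∣≡2⇒x∈p⇒x≡a⊎x≡b : ∀ {n} {p : Subset n} {a b x : Fin n} → ∣ p ∣ ≡ 2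
                   → a ∈ p → b ∈ p → a ≢ b → x ∈ p → x ≡ a ⊎ x ≡ b
∣p∣≡2⇒x∈p⇒x≡a⊎x≡b {a = a} {b} {x} ∣p∣≡2 a∈p b∈p a≢b x∈p with x ≟ a | x ≟ b
... | yes x≡a | _       = inj₁ x≡a
... | no _    | yes x≡b = inj₂ x≡b
... | no x≢a  | no x≢b  = ⊥-elim (<-irrefl refl (subst (2 <_) ∣p∣≡2
        (three-distinct⇒2<∣p∣ a∈p b∈p x∈p a≢b (≢-sym x≢a) (≢-sym x≢b))))

module _ {n : ℕ} (G : Graph n) where

  Adj-sym : ∀ {x y} → Adj G x y → Adj G y x
  Adj-sym {x} {y} = subst T (Graph.sym G x y)

  Adj⇒≢ : ∀ {x y} → Adj G x y → x ≢ y
  Adj⇒≢ {x} x~x refl = subst T (irrefl G x) x~x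

  Adj⇒∈N : ∀ {x y} → Adj G x y → y ∈ N G x
  Adj⇒∈N {x} {y} x~y =
    lookup⇒[]= y _ (trans (lookup∘tabulate (adj G x) y) (to T-≡ x~y))

  deg≡2⇒neighbour≡ : ∀ {u a b x} → deg G u ≡ 2 → Adj G u a → Adj G u b → a ≢ b
                   → Adj G u x → x ≡ a ⊎ x ≡ b
  deg≡2⇒neighbour≡ deg≡2 u~a u~b a≢b u~x =
    ∣p∣≡2⇒x∈p⇒x≡a⊎x≡b deg≡2 (Adj⇒∈N u~a) (Adj⇒∈N u~b) a≢b (Adj⇒∈N u~x)

  Twins : Fin n → Fin n → Set
  Twins u w = ∀ x → x ≢ u → x ≢ w → Adj G x u ⇔ Adj G x w

  triangle-deg≡2⇒Adj : ∀ {v s t x} → Adj G v s → Adj G v t → Adj G s t → deg G s ≡ 2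
                     → x ≢ t → Adj G x s → Adj G x t
  triangle-deg≡2⇒Adj v~s v~t s~t deg≡2 x≢t x~s
    with deg≡2⇒neighbour≡ deg≡2 (Adj-sym v~s) s~t (Adj⇒≢ v~t) (Adj-sym x~s)
  ... | inj₁ refl = v~t
  ... | inj₂ x≡t  = ⊥-elim (x≢t x≡t)

  triangle-deg≡2⇒Twins : ∀ {v u w} → Adj G v u → Adj G v w → Adj G u w
                       → deg G u ≡ 2 → deg G w ≡ 2 → Twins u w
  triangle-deg≡2⇒Twins v~u v~w u~w deg-u deg-w x x≢u x≢w =
    mk⇔ (triangle-deg≡2⇒Adj v~u v~w u~w deg-u x≢w)
        (triangle-deg≡2⇒Adj v~w v~u (Adj-sym u~w) deg-w x≢u)

  Twins⇒never-forced : ∀ {S u w} → u ≢ w → Twins u w → u ∉ S → w ∉ S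
                     → ∀ {x} → Closure G S x → x ≢ u × x ≢ w
  Twins⇒never-forced u≢w twins u∉S w∉S (base x∈S) =
    (λ { refl → u∉S x∈S }) , (λ { refl → w∉S x∈S })
  Twins⇒never-forced {S} {u} {w} u≢w twins u∉S w∉S (force {y} c y~x forced) =
    (λ { refl → proj₂ (never-forced (forced w (to (twins y y≢u y≢w) y~x) (≢-sym u≢w))) refl })
    , (λ { refl → proj₁ (never-forced (forced u (from (twins y y≢u y≢w) y~x) u≢w)) refl })
    where
    never-forced : ∀ {x} → Closure G S x → x ≢ u × x ≢ w
    never-forced = Twins⇒never-forced u≢w twins u∉S w∉S
    y≢u : y ≢ u
    y≢u = proj₁ (never-forced c)
    y≢w : y ≢ w
    y≢w = proj₂ (never-forced c)

lemma2p5 : (n : ℕ) (G : Graph n) → Connected G → HasPendantTriangle G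
         → FailedZFNumber≥ G (n ∸ 2)
lemma2p5 n G _ (v , u , w , _ , _ , v~u , v~w , u~w , deg-u , deg-w) =
  S , (u , λ u∈cl → proj₁ (never-forced u∈cl) refl) , ∣∁⁅x,y⁆∣≥n∸2 u w
  where
  S : Subset n
  S = ∁ (⁅ u ⁆ ∪ ⁅ w ⁆)
  u∉S : u ∉ S
  u∉S = x∈p⇒x∉∁p (x∈p∪q⁺ (inj₁ (x∈⁅x⁆ u)))
  w∉S : w ∉ S
  w∉S = x∈p⇒x∉∁p (x∈p∪q⁺ (inj₂ (x∈⁅x⁆ w)))
  never-forced : ∀ {x} → Closure G S x → x ≢ u × x ≢ w
  never-forced = Twins⇒never-forced G (Adj⇒≢ G u~w)
                   (triangle-deg≡2⇒Twins G v~u v~w u~w deg-u deg-w) u∉S w∉S
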